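{- Let $G$ be a MAX-acyclic, strongly connected simple stochastic game. Then for each MAX vertex $x$, all out-neighbours of $x$ but (at most) one are sinks.
   Context: A simple stochastic game (SSG) is a finite directed graph $G=(V,A)$ with a partition $V=V_{MAX}\cup V_{MIN}\cup V_{AVE}\cup V_{SINK}$; each sink's only outgoing arc is a loop on itself, each average vertex has outdegree exactly $2$, and positional vertices have at least one outgoing arc. A play is a sequence of vertices $x_0,x_1,\dots$ with $(x_t,x_{t+1})\in A$. The SSG is MAX-acyclic if for every MAX vertex $x$, for all outgoing arcs $a$ of $x$ but one, no play going through $a$ ever reaches $x$ again. It is strongly connected if the underlying directed graph with the sink vertices removed is strongly connected. -}

module Defs where

open import Data.Nat using (ℕ; suc; _<_)
open import Data.Fin using (Fin)
open import Data.Product using (Σ; ∃; _×_; _,_)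
open import Data.Sum using (_⊎_)
open import Relation.Binary.PropositionalEquality using (_≡_; _≢_)
open import Relation.Nullary using (¬_)

data Kind : Set where
  MAX MIN AVE SINK : Kind

record SSG (n : ℕ) : Set₁ where
  field
    Arc  : Fin n → Fin n → Set
    kind : Fin n → Kind
    sink-loop : ∀ x → kind x ≡ SINK → Arc x x
    sink-only : ∀ x y → kind x ≡ SINK → Arc x y → y ≡ x
    ave-deg2  : ∀ x → kind x ≡ AVE →
                Σ (Fin n) λ y → Σ (Fin n) λ z →
                  y ≢ z × Arc x y × Arc x z ×
                  (∀ w → Arc x w → w ≡ y ⊎ w ≡ z)
    max-out   : ∀ x → kind x ≡ MAX → ∃ λ y → Arc x y
    min-out   : ∀ x → kind x ≡ MIN → ∃ λ y → Arc x y

module _ {n : ℕ} (G : SSG n) where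
  open SSG G

  record Play : Set where
    field
      pos  : ℕ → Fin n
      step : ∀ t → Arc (pos t) (pos (suc t))

  ReturnsVia : Fin n → Fin n → Play → Set
  ReturnsVia x y p =
    Σ ℕ λ t → Σ ℕ λ t' →
      Play.pos p t ≡ x × Play.pos p (suc t) ≡ y × t < t' × Play.pos p t' ≡ x

  MaxAcyclic : Set
  MaxAcyclic = ∀ x → kind x ≡ MAX →
    Σ (Fin n) λ y0 → Arc x y0 ×
      (∀ y → Arc x y → y ≢ y0 → ∀ (p : Play) → ¬ ReturnsVia x y p)

  -- directed paths in the graph with the sink vertices removed
  data Path : Fin n → Fin n → Set where
    here  : ∀ {u} → kind u ≢ SINK → Path u u
    there : ∀ {u v w} → kind u ≢ SINK → Arc u v → Path v w → Path u w

  StronglyConnected : Set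
  StronglyConnected = ∀ u v → kind u ≢ SINK → kind v ≢ SINK → Path u v

-- If x is a MAX vertex with an arc to a non-sink y, strong connectivity gives a path
-- back from y to x; going round the cycle x → y ⇝ x forever is a play that leaves x
-- through (x , y) and returns to x. MAX-acyclicity forbids this for every arc of x
-- but one, so all other successors of x are sinks.
module Submission where

open import Defs
open import Data.Nat using (ℕ; zero; suc; s≤s; z≤n)
open import Data.Nat.GeneralisedArithmetic using (fold; iterate; iterate-is-fold)
open import Data.Fin using (Fin)
open import Data.Product using (Σ; _,_; proj₁)
open import Data.Empty using (⊥-elim)
open import Function using (_∘_)
open import Relation.Nullary using (¬_)
open import Relation.Binary.PropositionalEquality using (_≡_; _≢_; refl; cong; sym; trans)

MAX≢SINK : MAX ≢ SINK
MAX≢SINK ()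

≢SINK-stable : ∀ {k} → ¬ k ≢ SINK → k ≡ SINK
≢SINK-stable {MAX}  k≢SINK-absurd = ⊥-elim (k≢SINK-absurd λ ())
≢SINK-stable {MIN}  k≢SINK-absurd = ⊥-elim (k≢SINK-absurd λ ())
≢SINK-stable {AVE}  k≢SINK-absurd = ⊥-elim (k≢SINK-absurd λ ())
≢SINK-stable {SINK} _             = refl

module _ {n : ℕ} (G : SSG n) where
  open SSG G

  Path-length : ∀ {u v} → Path G u v → ℕ
  Path-length (here _)      = zero
  Path-length (there _ _ p) = suc (Path-length p)

  Path-target-≢SINK : ∀ {u v} → Path G u v → kind v ≢ SINK
  Path-target-≢SINK (here v≢SINK) = v≢SINK
  Path-target-≢SINK (there _ _ p) = Path-target-≢SINK p

  module _ {x y : Fin n} (x→y : Arc x y) (y⇝x : Path G y x) where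

    -- A state of the walk round the cycle: the current vertex and what remains of the way back to x.
    private
      State : Set
      State = Σ (Fin n) λ v → Path G v x

      start : State
      start = x , here (Path-target-≢SINK y⇝x)

      next : State → State
      next (_ , here _)               = y , y⇝x
      next (_ , there {v = v} _ _ p) = v , p

      next-arc : ∀ s → Arc (proj₁ s) (proj₁ (next s))
      next-arc (_ , here _)        = x→y
      next-arc (_ , there _ v→w _) = v→w

      walk-back : ∀ {v} (p : Path G v x) → iterate next (v , p) (Path-length p) ≡ start
      walk-back (here _)      = refl
      walk-back (there _ _ p) = walk-back p

    -- fold makes each step of the play definitional; iterate makes walk-back structural.
    cyclePlay : Play G
    cyclePlay = record
      { pos  = proj₁ ∘ fold start next
      ; step = next-arc ∘ fold start next
      }

    cyclePlay-returnsVia : ReturnsVia G x y cyclePlay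
    cyclePlay-returnsVia =
      zero , suc (Path-length y⇝x) , refl , refl , s≤s z≤n ,
      cong proj₁ (trans (iterate-is-fold start next (suc (Path-length y⇝x))) (walk-back y⇝x))

lemma3 : ∀ {n} (G : SSG n) → MaxAcyclic G → StronglyConnected G →
         ∀ x → SSG.kind G x ≡ MAX →
         Σ (Fin n) λ y0 → ∀ y → SSG.Arc G x y → y ≢ y0 → SSG.kind G y ≡ SINK
lemma3 G acyclic connected x x-max with acyclic x x-max
... | y₀ , _ , no-return = y₀ , λ y x→y y≢y₀ → ≢SINK-stable λ y≢SINK →
        let y⇝x = connected y x y≢SINK (MAX≢SINK ∘ trans (sym x-max))
        in  no-return y x→y y≢y₀ (cyclePlay G x→y y⇝x) (cyclePlay-returnsVia G x→y y⇝x)
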